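{- Let $l\mid n$ and $E=\mathbb F_{2^l}\subset\mathbb F_{2^n}$, and let $L_E(X)=\prod_{u\in E}(X-u)$. Let $U\subset L_E(\mathbb F_{2^n})$ be an $\mathbb F_2$-subspace with $\dim_{\mathbb F_2}U=r$ and $\dim_{\mathbb F_{2^l}}\mathbb F_{2^l}U=s$. (i) If $V\subset\mathbb F_{2^n}$ is an $\mathbb F_2$-subspace with $\dim_{\mathbb F_2}V=r$ and $L_E(V)=U$, then $s\le\dim_{\mathbb F_{2^l}}\mathbb F_{2^l}V\le s+1$. (ii) There exists an $\mathbb F_2$-subspace $V\subset\mathbb F_{2^n}$ with $\dim_{\mathbb F_2}V=r$, $L_E(V)=U$ and $\dim_{\mathbb F_{2^l}}\mathbb F_{2^l}V=s$.
   Context: $L_E$ is an $\mathbb F_2$-linear (indeed $\mathbb F_{2^l}$-linear) map $\mathbb F_{2^n}\to\mathbb F_{2^n}$ with kernel $E$. For an $\mathbb F_2$-subspace $W$, $\mathbb F_{2^l}W$ denotes its $\mathbb F_{2^l}$-span. -}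

module Defs where

open import Level using (0ℓ)
open import Data.Nat using (ℕ; suc; _^_)
open import Data.Fin using (Fin)
open import Data.List using (List; foldr; length)
open import Data.List.Membership.Propositional using (_∈_)
open import Data.List.Relation.Unary.Unique.Propositional using (Unique)
open import Data.Product using (Σ; _×_; _,_; ∃)
open import Data.Sum using (_⊎_)
open import Relation.Nullary using (¬_)
open import Relation.Binary.PropositionalEquality using (_≡_)
open import Algebra.Structures using (IsCommutativeRing)
open import Function.Bundles using (_↔_; _⇔_)

record Field : Set₁ where
  infixl 7 _*_
  infixl 6 _+_ _-_
  field
    Carrier : Set
    _+_ _*_ : Carrier → Carrier → Carrier
    -_      : Carrier → Carrier
    0# 1#   : Carrier
    isCommutativeRing : IsCommutativeRing _≡_ _+_ _*_ -_ 0# 1#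
    0≢1     : ¬ (0# ≡ 1#)
    inv     : (x : Carrier) → ¬ (x ≡ 0#) → Σ Carrier (λ y → x * y ≡ 1#)

  _-_ : Carrier → Carrier → Carrier
  x - y = x + (- y)

HasCard : Set → ℕ → Set
HasCard A q = A ↔ Fin q

module _ (K : Field) where
  open Field K

  Subset : Set₁
  Subset = Carrier → Set

  -- A subfield of K, given with an exhaustive duplicate-free list of its
  -- elements (so that products over the subfield make sense).
  record Subfield : Set₁ where
    field
      mem      : Subset
      elems    : List Carrier
      unique   : Unique elems
      complete : ∀ x → mem x ⇔ (x ∈ elems)
      0∈       : mem 0#
      1∈       : mem 1#
      +-closed : ∀ {x y} → mem x → mem y → mem (x + y)
      *-closed : ∀ {x y} → mem x → mem y → mem (x * y)
      neg-closed : ∀ {x} → mem x → mem (- x)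
      inv-closed : ∀ {x y} → mem x → x * y ≡ 1# → mem y

  order : Subfield → ℕ
  order E = length (Subfield.elems E)

  L : Subfield → Carrier → Carrier
  L E x = foldr (λ u acc → (x - u) * acc) 1# (Subfield.elems E)

  F₂ : Subset
  F₂ x = (x ≡ 0#) ⊎ (x ≡ 1#)

  sumFin : (m : ℕ) → (Fin m → Carrier) → Carrier
  sumFin ℕ.zero f = 0#
  sumFin (suc m) f = f Fin.zero + sumFin m (λ i → f (Fin.suc i))

  lincomb : (m : ℕ) → (Fin m → Carrier) → (Fin m → Carrier) → Carrier
  lincomb m c b = sumFin m (λ i → c i * b i)

  record IsSubspace (F : Subset) (S : Subset) : Set where
    field
      0∈      : S 0#
      +-closed : ∀ {x y} → S x → S y → S (x + y)
      ·-closed : ∀ {a x} → F a → S x → S (a * x)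

  span : (F : Subset) → Subset → Subset
  span F W x = Σ ℕ λ m → Σ (Fin m → Carrier) λ a → Σ (Fin m → Carrier) λ w →
                 (∀ i → F (a i)) × (∀ i → W (w i)) × (x ≡ lincomb m a w)

  record IsBasis (F : Subset) (S : Subset) (d : ℕ) (b : Fin d → Carrier) : Set where
    field
      inS        : ∀ i → S (b i)
      independent : ∀ (c : Fin d → Carrier) → (∀ i → F (c i)) →
                    lincomb d c b ≡ 0# → ∀ i → c i ≡ 0#
      spanning   : ∀ x → S x → Σ (Fin d → Carrier) λ c → (∀ i → F (c i)) × (x ≡ lincomb d c b)

  HasDim : (F : Subset) → Subset → ℕ → Set
  HasDim F S d = Σ (Fin d → Carrier) (IsBasis F S d)

  ImageIs : (Carrier → Carrier) → Subset → Subset → Set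
  ImageIs f V U = ∀ y → U y ⇔ (Σ Carrier λ v → V v × (f v ≡ y))

  InRange : (Carrier → Carrier) → Subset → Set
  InRange f U = ∀ y → U y → Σ Carrier λ x → f x ≡ y

{-# OPTIONS --safe #-}
module Submission where

open import Defs
open import Level using (Level; 0ℓ)
open import Data.Nat as ℕ using (ℕ; zero; suc; _≤_; z≤n; s≤s)
import Data.Nat.Properties as ℕ
open import Data.Nat.Divisibility using (_∣_)
open import Data.Integer as ℤ using (ℤ)
import Data.Integer.Properties as ℤ
open import Data.Fin using (Fin; zero; suc; punchIn)
import Data.Fin.Properties as Fin
open import Data.Vec.Functional using (insertAt; removeAt)
open import Data.Vec.Functional.Properties using (insertAt-lookup; insertAt-punchIn)
open import Data.Vec as Vec using (Vec; []; _∷_)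
open import Data.List as List using (List; []; _∷_; foldr; length; filter)
open import Data.List.Membership.Propositional using (_∈_)
open import Data.List.Membership.Propositional.Properties using (∈-map⁺; ∈-map⁻; ∈-filter⁺; ∈-filter⁻)
open import Data.List.Membership.Propositional.Properties.WithK using (unique∧set⇒bag)
open import Data.List.Relation.Unary.Any using (here; there)
open import Data.List.Relation.Unary.All as All using (All; []; _∷_)
open import Data.List.Relation.Unary.AllPairs using ([]; _∷_)
open import Data.List.Relation.Unary.Unique.Propositional using (Unique)
import Data.List.Relation.Unary.Unique.Propositional.Properties as Unique
open import Data.List.Relation.Binary.Permutation.Propositional using (_↭_; ↭⇒↭ₛ)
open import Data.List.Relation.Binary.Permutation.Propositional.Properties using (↭-length)
open import Data.List.Relation.Binary.BagAndSetEquality using (∼bag⇒↭)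
open import Data.Maybe using (Maybe; just; nothing)
open import Data.Product using (Σ; ∃; _×_; _,_; proj₁; proj₂)
open import Data.Sum using (inj₁; inj₂)
open import Data.Unit using (⊤; tt)
open import Data.Empty using (⊥-elim)
open import Relation.Nullary using (yes; no; ¬?)
open import Relation.Binary.Definitions using (DecidableEquality)
open import Relation.Binary.PropositionalEquality as ≡
  using (_≡_; _≢_; refl; sym; trans; cong; cong₂; subst; module ≡-Reasoning)
open import Algebra.Bundles using (CommutativeRing)
open import Function.Bundles using (Equivalence; mk⇔)
open import Function.Properties.Inverse using (↔⇒↣)

-- With q = |E| = 2^l, the polynomial L_E(X) = ∏_{u ∈ E} (X - u) equals X^q - X: both are monic of
-- degree q and vanish on E, the latter by Fermat's little theorem in E. Since q is even, K has
-- characteristic 2, so L_E is additive by the Frobenius identity, E-linear, and has kernel E.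
-- (i) L_E maps span_E V onto span_E U, so s ≤ t by the Steinitz exchange lemma; conversely span_E V
-- is spanned by 1 together with lifts of an E-basis of span_E U, because the kernel is E = E·1.
-- (ii) Lift an E-basis e of span_E U to y. L_E is injective on span_E y, so
-- V = {x ∈ span_E y : L_E x ∈ U} is mapped bijectively onto U, and y is an E-basis of span_E V.

-- The ring solver needs coefficients whose arithmetic computes, so they are taken in ℤ, which maps
-- into every commutative ring. The type-checking-optimised multiples make ⟦ + 1 ⟧ℤ reduce to 1#,
-- so that solved equations mention 1# itself.
module IntegerCoefficientSolver {c ℓ : Level} (R : CommutativeRing c ℓ) where
  open import Data.Integer using (+_; -[1+_])
  open CommutativeRing R
    renaming (refl to ≈-refl; sym to ≈-sym; trans to ≈-trans; reflexive to ≈-reflexive)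
  open import Algebra.Properties.Ring ring using (-‿distribˡ-*; -‿distribʳ-*; -‿involutive; -0#≈0#; -‿+-comm)
  open import Algebra.Properties.Semiring.Mult.TCOptimised semiring
    using (1+×; ×-homo-+; ×1-homo-*) renaming (_×_ to _×′_)
  open import Algebra.Solver.Ring.AlmostCommutativeRing
    using (fromCommutativeRing; _-Raw-AlmostCommutative⟶_)
  open import Relation.Binary.Reasoning.Setoid setoid

  ⟦_⟧ℤ : ℤ → Carrier
  ⟦ + n ⟧ℤ = n ×′ 1#
  ⟦ -[1+ n ] ⟧ℤ = - (suc n ×′ 1#)

  ⊖-homo : ∀ m n → ⟦ m ℤ.⊖ n ⟧ℤ ≈ m ×′ 1# - n ×′ 1#
  ⊖-homo zero zero = ≈-sym (≈-trans (+-congˡ -0#≈0#) (+-identityʳ 0#))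
  ⊖-homo zero (suc n) = ≈-sym (+-identityˡ _)
  ⊖-homo (suc m) zero = ≈-sym (≈-trans (+-congˡ -0#≈0#) (+-identityʳ _))
  ⊖-homo (suc m) (suc n) = begin
    ⟦ suc m ℤ.⊖ suc n ⟧ℤ        ≡⟨ cong ⟦_⟧ℤ (ℤ.[1+m]⊖[1+n]≡m⊖n m n) ⟩
    ⟦ m ℤ.⊖ n ⟧ℤ                ≈⟨ ⊖-homo m n ⟩
    a - b                       ≈⟨ +-congˡ (+-identityˡ (- b)) ⟨
    a + (0# + - b)              ≈⟨ +-congˡ (+-congʳ (-‿inverseʳ 1#)) ⟨
    a + ((1# + - 1#) + - b)     ≈⟨ +-congˡ (+-assoc 1# (- 1#) (- b)) ⟩
    a + (1# + (- 1# + - b))     ≈⟨ +-assoc a 1# _ ⟨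
    (a + 1#) + (- 1# + - b)     ≈⟨ +-cong (+-comm a 1#) (-‿+-comm 1# b) ⟩
    (1# + a) - (1# + b)         ≈⟨ +-cong (1+× m 1#) (-‿cong (1+× n 1#)) ⟨
    suc m ×′ 1# - suc n ×′ 1#   ∎
    where
    a = m ×′ 1#
    b = n ×′ 1#

  -‿homo : ∀ i → ⟦ ℤ.- i ⟧ℤ ≈ - ⟦ i ⟧ℤ
  -‿homo (+ zero) = ≈-sym -0#≈0#
  -‿homo (+ suc n) = ≈-refl
  -‿homo -[1+ n ] = ≈-sym (-‿involutive _)

  +-homo : ∀ i j → ⟦ i ℤ.+ j ⟧ℤ ≈ ⟦ i ⟧ℤ + ⟦ j ⟧ℤ
  +-homo (+ m) (+ n) = ×-homo-+ 1# m n
  +-homo (+ m) -[1+ n ] = ⊖-homo m (suc n)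
  +-homo -[1+ m ] (+ n) = ≈-trans (⊖-homo n (suc m)) (+-comm _ _)
  +-homo -[1+ m ] -[1+ n ] = begin
    - (suc (suc (m ℕ.+ n)) ×′ 1#)      ≡⟨ cong (λ k → - (suc k ×′ 1#)) (ℕ.+-suc m n) ⟨
    - ((suc m ℕ.+ suc n) ×′ 1#)        ≈⟨ -‿cong (×-homo-+ 1# (suc m) (suc n)) ⟩
    - (suc m ×′ 1# + suc n ×′ 1#)      ≈⟨ -‿+-comm _ _ ⟨
    - (suc m ×′ 1#) + - (suc n ×′ 1#)  ∎

  *-homo-+ : ∀ i n → ⟦ i ℤ.* + n ⟧ℤ ≈ ⟦ i ⟧ℤ * ⟦ + n ⟧ℤ
  *-homo-+ (+ m) n = ≈-trans (≈-reflexive (cong ⟦_⟧ℤ (sym (ℤ.pos-* m n)))) (×1-homo-* m n)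
  *-homo-+ -[1+ m ] n = begin
    ⟦ -[1+ m ] ℤ.* + n ⟧ℤ        ≡⟨ cong ⟦_⟧ℤ (ℤ.neg-distribˡ-* (+ suc m) (+ n)) ⟨
    ⟦ ℤ.- (+ suc m ℤ.* + n) ⟧ℤ   ≈⟨ -‿homo (+ suc m ℤ.* + n) ⟩
    - ⟦ + suc m ℤ.* + n ⟧ℤ       ≈⟨ -‿cong (*-homo-+ (+ suc m) n) ⟩
    - (⟦ + suc m ⟧ℤ * ⟦ + n ⟧ℤ)  ≈⟨ -‿distribˡ-* _ _ ⟩
    ⟦ -[1+ m ] ⟧ℤ * ⟦ + n ⟧ℤ     ∎

  *-homo : ∀ i j → ⟦ i ℤ.* j ⟧ℤ ≈ ⟦ i ⟧ℤ * ⟦ j ⟧ℤ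
  *-homo i (+ n) = *-homo-+ i n
  *-homo i -[1+ n ] = begin
    ⟦ i ℤ.* -[1+ n ] ⟧ℤ          ≡⟨ cong ⟦_⟧ℤ (ℤ.neg-distribʳ-* i (+ suc n)) ⟨
    ⟦ ℤ.- (i ℤ.* + suc n) ⟧ℤ     ≈⟨ -‿homo (i ℤ.* + suc n) ⟩
    - ⟦ i ℤ.* + suc n ⟧ℤ         ≈⟨ -‿cong (*-homo-+ i (suc n)) ⟩
    - (⟦ i ⟧ℤ * ⟦ + suc n ⟧ℤ)    ≈⟨ -‿distribʳ-* _ _ ⟩
    ⟦ i ⟧ℤ * ⟦ -[1+ n ] ⟧ℤ       ∎

  ℤ-homomorphism : CommutativeRing.rawRing ℤ.+-*-commutativeRing -Raw-AlmostCommutative⟶ fromCommutativeRing R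
  ℤ-homomorphism = record
    { ⟦_⟧ = ⟦_⟧ℤ ; +-homo = +-homo ; *-homo = *-homo ; -‿homo = -‿homo
    ; 0-homo = ≈-refl ; 1-homo = ≈-refl
    }

  ⟦⟧ℤ-weaklyDecidable : ∀ i j → Maybe (⟦ i ⟧ℤ ≈ ⟦ j ⟧ℤ)
  ⟦⟧ℤ-weaklyDecidable i j with i ℤ.≟ j
  ... | yes refl = just ≈-refl
  ... | no _ = nothing

  open import Algebra.Solver.Ring (CommutativeRing.rawRing ℤ.+-*-commutativeRing) (fromCommutativeRing R)
    ℤ-homomorphism ⟦⟧ℤ-weaklyDecidable public

  :0 :1 : ∀ {n} → Polynomial n
  :0 = con (+ 0)
  :1 = con (+ 1)

module FieldProperties (K : Field) where
  open Field K public

  commutativeRing : CommutativeRing 0ℓ 0ℓ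
  commutativeRing = record { isCommutativeRing = isCommutativeRing }

  open CommutativeRing commutativeRing public
    using ( +-assoc; +-identityˡ; +-identityʳ; -‿inverseʳ; *-assoc; *-comm; *-identityˡ; *-identityʳ
          ; zeroˡ; zeroʳ; ring; semiring; commutativeSemiring; *-isCommutativeMonoid)
  open IntegerCoefficientSolver commutativeRing public
    using (solve; _:=_; _:+_; _:*_; :-_; _:-_; _:^_; :0; :1)
  open import Algebra.Properties.Semiring.Exp semiring public using (_^_; ^-assocʳ)
  open import Algebra.Properties.CommutativeSemiring.Exp commutativeSemiring public using (^-distrib-*)
  open import Algebra.Properties.Ring ring public using (x∙y⁻¹≈ε⇒x≈y)
  open ≡-Reasoning

  x*y≡0⇒y≡0 : ∀ {x y} → x ≢ 0# → x * y ≡ 0# → y ≡ 0#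
  x*y≡0⇒y≡0 {x} {y} x≢0 xy≡0 with inv x x≢0
  ... | x′ , xx′≡1 = begin
    y                ≡⟨ *-identityʳ y ⟨
    y * 1#           ≡⟨ cong (y *_) xx′≡1 ⟨
    y * (x * x′)     ≡⟨ solve 3 (λ x y x′ → y :* (x :* x′) := (x :* y) :* x′) refl x y x′ ⟩
    (x * y) * x′     ≡⟨ cong (_* x′) xy≡0 ⟩
    0# * x′          ≡⟨ zeroˡ x′ ⟩
    0#               ∎

  *-≢0 : ∀ {x y} → x ≢ 0# → y ≢ 0# → x * y ≢ 0#
  *-≢0 x≢0 y≢0 xy≡0 = y≢0 (x*y≡0⇒y≡0 x≢0 xy≡0)

  x-y≡0⇒x≡y : ∀ {x y} → x - y ≡ 0# → x ≡ y
  x-y≡0⇒x≡y = x∙y⁻¹≈ε⇒x≈y _ _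

  div : (x y : Carrier) → y ≢ 0# → Carrier
  div x y y≢0 = x * proj₁ (inv y y≢0)

  div-*-cancel : ∀ x y (y≢0 : y ≢ 0#) → div x y y≢0 * y ≡ x
  div-*-cancel x y y≢0 with inv y y≢0
  ... | y′ , yy′≡1 = begin
    (x * y′) * y  ≡⟨ solve 3 (λ x y y′ → (x :* y′) :* y := x :* (y :* y′)) refl x y y′ ⟩
    x * (y * y′)  ≡⟨ cong (x *_) yy′≡1 ⟩
    x * 1#        ≡⟨ *-identityʳ x ⟩
    x             ∎

  *-cancelˡ-≢0 : ∀ {z x y} → z ≢ 0# → z * x ≡ z * y → x ≡ y
  *-cancelˡ-≢0 {z} {x} {y} z≢0 zx≡zy = x-y≡0⇒x≡y (x*y≡0⇒y≡0 z≢0 (begin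
    z * (x - y)    ≡⟨ solve 3 (λ z x y → z :* (x :- y) := z :* x :- z :* y) refl z x y ⟩
    z * x - z * y  ≡⟨ cong (λ u → u - z * y) zx≡zy ⟩
    z * y - z * y  ≡⟨ -‿inverseʳ (z * y) ⟩
    0#             ∎))

  1^n≡1 : ∀ n → 1# ^ n ≡ 1#
  1^n≡1 zero = refl
  1^n≡1 (suc n) = trans (*-identityˡ _) (1^n≡1 n)

  module _ (char2 : 1# + 1# ≡ 0#) where

    square-+ : ∀ x y → (x + y) ^ 2 ≡ x ^ 2 + y ^ 2
    square-+ x y = begin
      (x + y) ^ 2
        ≡⟨ solve 2 (λ x y → (x :+ y) :^ 2 := x :^ 2 :+ y :^ 2 :+ (:1 :+ :1) :* (x :* y)) refl x y ⟩
      x ^ 2 + y ^ 2 + (1# + 1#) * (x * y)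
        ≡⟨ cong (λ c → x ^ 2 + y ^ 2 + c * (x * y)) char2 ⟩
      x ^ 2 + y ^ 2 + 0# * (x * y)
        ≡⟨ solve 3 (λ a b c → a :+ b :+ :0 :* c := a :+ b) refl (x ^ 2) (y ^ 2) (x * y) ⟩
      x ^ 2 + y ^ 2  ∎

    frobenius : ∀ j x y → (x + y) ^ (2 ℕ.^ j) ≡ x ^ (2 ℕ.^ j) + y ^ (2 ℕ.^ j)
    frobenius zero x y = solve 2 (λ x y → (x :+ y) :^ 1 := x :^ 1 :+ y :^ 1) refl x y
    frobenius (suc j) x y = begin
      (x + y) ^ (2 ℕ.* n)                ≡⟨ ^-assocʳ (x + y) 2 n ⟨
      ((x + y) ^ 2) ^ n                  ≡⟨ cong (_^ n) (square-+ x y) ⟩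
      (x ^ 2 + y ^ 2) ^ n                ≡⟨ frobenius j (x ^ 2) (y ^ 2) ⟩
      (x ^ 2) ^ n + (y ^ 2) ^ n          ≡⟨ cong₂ _+_ (^-assocʳ x 2 n) (^-assocʳ y 2 n) ⟩
      x ^ (2 ℕ.* n) + y ^ (2 ℕ.* n)      ∎
      where
      n = 2 ℕ.^ j

module _ (K : Field) where
  open Field K

  record IsSubfield (P : Subset K) : Set where
    field
      0∈         : P 0#
      1∈         : P 1#
      +-closed   : ∀ {x y} → P x → P y → P (x + y)
      *-closed   : ∀ {x y} → P x → P y → P (x * y)
      neg-closed : ∀ {x} → P x → P (- x)
      inv-closed : ∀ {x y} → P x → x * y ≡ 1# → P y

  subfield⇒isSubfield : (E : Subfield K) → IsSubfield (Subfield.mem E)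
  subfield⇒isSubfield E = record { Subfield E }

  F₂⊆subfield : (E : Subfield K) → ∀ {a} → F₂ K a → Subfield.mem E a
  F₂⊆subfield E (inj₁ refl) = Subfield.0∈ E
  F₂⊆subfield E (inj₂ refl) = Subfield.1∈ E

  record IsLinear (P : Subset K) (f : Carrier → Carrier) : Set where
    field
      +-homo : ∀ x y → f (x + y) ≡ f x + f y
      *-homo : ∀ {a} x → P a → f (a * x) ≡ a * f x

module LinearCombination (K : Field) where
  open FieldProperties K
  open ≡-Reasoning

  lincomb-cong : ∀ m {c d v w : Fin m → Carrier} → (∀ i → c i * v i ≡ d i * w i) →
                 lincomb K m c v ≡ lincomb K m d w
  lincomb-cong zero eq = refl
  lincomb-cong (suc m) eq = cong₂ _+_ (eq zero) (lincomb-cong m (λ i → eq (suc i)))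

  lincomb-zero : ∀ m (v : Fin m → Carrier) → lincomb K m (λ _ → 0#) v ≡ 0#
  lincomb-zero zero v = refl
  lincomb-zero (suc m) v =
    trans (cong₂ _+_ (zeroˡ (v zero)) (lincomb-zero m (λ i → v (suc i)))) (+-identityˡ 0#)

  lincomb-+ : ∀ m (c d v : Fin m → Carrier) →
              lincomb K m (λ i → c i + d i) v ≡ lincomb K m c v + lincomb K m d v
  lincomb-+ zero c d v = sym (+-identityˡ 0#)
  lincomb-+ (suc m) c d v =
    trans (cong (((c zero + d zero) * v zero) +_)
                (lincomb-+ m (λ i → c (suc i)) (λ i → d (suc i)) (λ i → v (suc i))))
          (solve 5 (λ c d v C D → (c :+ d) :* v :+ (C :+ D) := (c :* v :+ C) :+ (d :* v :+ D)) refl _ _ _ _ _)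

  lincomb-* : ∀ m a (c v : Fin m → Carrier) → lincomb K m (λ i → a * c i) v ≡ a * lincomb K m c v
  lincomb-* zero a c v = sym (zeroʳ a)
  lincomb-* (suc m) a c v =
    trans (cong (((a * c zero) * v zero) +_) (lincomb-* m a (λ i → c (suc i)) (λ i → v (suc i))))
          (solve 4 (λ a c v C → a :* c :* v :+ a :* C := a :* (c :* v :+ C)) refl _ _ _ _)

  lincomb-subˡ : ∀ m a (c d v : Fin m → Carrier) →
                lincomb K m (λ i → c i - a * d i) v ≡ lincomb K m c v - a * lincomb K m d v
  lincomb-subˡ zero a c d v = solve 1 (λ a → :0 := :0 :- a :* :0) refl a
  lincomb-subˡ (suc m) a c d v = begin
    (c₀ - a * d₀) * v₀ + lincomb K m (λ i → c (suc i) - a * d (suc i)) (λ i → v (suc i))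
      ≡⟨ cong (((c₀ - a * d₀) * v₀) +_)
              (lincomb-subˡ m a (λ i → c (suc i)) (λ i → d (suc i)) (λ i → v (suc i))) ⟩
    (c₀ - a * d₀) * v₀ + (C - a * D)
      ≡⟨ solve 6 (λ c₀ d₀ v₀ a C D → (c₀ :- a :* d₀) :* v₀ :+ (C :- a :* D)
                                   := (c₀ :* v₀ :+ C) :- a :* (d₀ :* v₀ :+ D)) refl c₀ d₀ v₀ a C D ⟩
    (c₀ * v₀ + C) - a * (d₀ * v₀ + D)  ∎
    where
    c₀ = c zero
    d₀ = d zero
    v₀ = v zero
    C = lincomb K m (λ i → c (suc i)) (λ i → v (suc i))
    D = lincomb K m (λ i → d (suc i)) (λ i → v (suc i))

  lincomb-subʳ : ∀ m (c u a : Fin m → Carrier) z →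
                  lincomb K m c (λ i → u i - a i * z) ≡ lincomb K m c u - lincomb K m c a * z
  lincomb-subʳ zero c u a z = solve 1 (λ z → :0 := :0 :- :0 :* z) refl z
  lincomb-subʳ (suc m) c u a z = begin
    c₀ * (u₀ - a₀ * z) + lincomb K m (λ i → c (suc i)) (λ i → u (suc i) - a (suc i) * z)
      ≡⟨ cong ((c₀ * (u₀ - a₀ * z)) +_)
              (lincomb-subʳ m (λ i → c (suc i)) (λ i → u (suc i)) (λ i → a (suc i)) z) ⟩
    c₀ * (u₀ - a₀ * z) + (U - A * z)
      ≡⟨ solve 6 (λ c₀ u₀ a₀ z U A → c₀ :* (u₀ :- a₀ :* z) :+ (U :- A :* z)
                                   := (c₀ :* u₀ :+ U) :- (c₀ :* a₀ :+ A) :* z) refl c₀ u₀ a₀ z U A ⟩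
    (c₀ * u₀ + U) - (c₀ * a₀ + A) * z  ∎
    where
    c₀ = c zero
    u₀ = u zero
    a₀ = a zero
    U = lincomb K m (λ i → c (suc i)) (λ i → u (suc i))
    A = lincomb K m (λ i → c (suc i)) (λ i → a (suc i))

  lincomb-removeAt : ∀ m (c v : Fin (suc m) → Carrier) p →
                     lincomb K (suc m) c v ≡ c p * v p + lincomb K m (removeAt c p) (removeAt v p)
  lincomb-removeAt m c v zero = refl
  lincomb-removeAt (suc m) c v (suc p) = begin
    c zero * v zero + lincomb K (suc m) (λ i → c (suc i)) (λ i → v (suc i))
      ≡⟨ cong ((c zero * v zero) +_) (lincomb-removeAt m (λ i → c (suc i)) (λ i → v (suc i)) p) ⟩
    c zero * v zero + (c (suc p) * v (suc p) + R)
      ≡⟨ solve 3 (λ x y R → x :+ (y :+ R) := y :+ (x :+ R)) refl (c zero * v zero) (c (suc p) * v (suc p)) R ⟩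
    c (suc p) * v (suc p) + (c zero * v zero + R)  ∎
    where
    R = lincomb K m (removeAt (λ i → c (suc i)) p) (removeAt (λ i → v (suc i)) p)

  lincomb-insertAt : ∀ m (c : Fin m → Carrier) p a (v : Fin (suc m) → Carrier) →
                     lincomb K (suc m) (insertAt c p a) v ≡ a * v p + lincomb K m c (removeAt v p)
  lincomb-insertAt m c p a v = begin
    lincomb K (suc m) (insertAt c p a) v
      ≡⟨ lincomb-removeAt m (insertAt c p a) v p ⟩
    insertAt c p a p * v p + lincomb K m (removeAt (insertAt c p a) p) (removeAt v p)
      ≡⟨ cong₂ (λ x y → x * v p + y) (insertAt-lookup c p a)
               (lincomb-cong m (λ i → cong (_* v (punchIn p i)) (insertAt-punchIn c p a i))) ⟩
    a * v p + lincomb K m c (removeAt v p)  ∎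

  unitVector : ∀ {m} → Fin (suc m) → Fin (suc m) → Carrier
  unitVector p = insertAt (λ _ → 0#) p 1#

  lincomb-unitVector : ∀ m p (v : Fin (suc m) → Carrier) → lincomb K (suc m) (unitVector p) v ≡ v p
  lincomb-unitVector m p v = begin
    lincomb K (suc m) (unitVector p) v                 ≡⟨ lincomb-insertAt m (λ _ → 0#) p 1# v ⟩
    1# * v p + lincomb K m (λ _ → 0#) (removeAt v p)   ≡⟨ cong₂ _+_ (*-identityˡ (v p)) (lincomb-zero m _) ⟩
    v p + 0#                                           ≡⟨ +-identityʳ (v p) ⟩
    v p                                                ∎

insertAt-closed : ∀ {A : Set} (Q : A → Set) {m} {xs : Fin m → A} {x} p →
                  (∀ i → Q (xs i)) → Q x → ∀ i → Q (insertAt xs p x i)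
insertAt-closed Q zero Qxs Qx zero = Qx
insertAt-closed Q zero Qxs Qx (suc i) = Qxs i
insertAt-closed Q {suc m} (suc p) Qxs Qx zero = Qxs zero
insertAt-closed Q {suc m} (suc p) Qxs Qx (suc i) = insertAt-closed Q p (λ j → Qxs (suc j)) Qx i

module Span (K : Field) {P : Subset K} (P-subfield : IsSubfield K P) where
  open FieldProperties K
  open LinearCombination K
  open IsSubfield P-subfield
  open ≡-Reasoning

  InSpan : ∀ {k} → (Fin k → Carrier) → Carrier → Set
  InSpan {k} y x = Σ (Fin k → Carrier) λ c → (∀ i → P (c i)) × (x ≡ lincomb K k c y)

  LinearlyIndependent : ∀ {t} → (Fin t → Carrier) → Set
  LinearlyIndependent {t} w = ∀ c → (∀ i → P (c i)) → lincomb K t c w ≡ 0# → ∀ i → c i ≡ 0#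

  div-closed : ∀ {x y} → P x → P y → (y≢0 : y ≢ 0#) → P (div x y y≢0)
  div-closed Px Py y≢0 = *-closed Px (inv-closed Py (proj₂ (inv _ y≢0)))

  lincomb-closed : ∀ m {c v : Fin m → Carrier} → (∀ i → P (c i)) → (∀ i → P (v i)) → P (lincomb K m c v)
  lincomb-closed zero Pc Pv = 0∈
  lincomb-closed (suc m) Pc Pv =
    +-closed (*-closed (Pc zero) (Pv zero)) (lincomb-closed m (λ i → Pc (suc i)) (λ i → Pv (suc i)))

  unitVector-closed : ∀ {m} (p i : Fin (suc m)) → P (unitVector p i)
  unitVector-closed p = insertAt-closed P p (λ _ → 0∈) 1∈

  InSpan-generator : ∀ {k} (y : Fin k → Carrier) j → InSpan y (y j)
  InSpan-generator {suc k} y j = unitVector j , unitVector-closed j , sym (lincomb-unitVector k j y)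

  InSpan-lincomb : ∀ {k} {y : Fin k → Carrier} m {a v : Fin m → Carrier} →
                   (∀ i → P (a i)) → (∀ i → InSpan y (v i)) → InSpan y (lincomb K m a v)
  InSpan-lincomb {k} {y} zero Pa v∈ = (λ _ → 0#) , (λ _ → 0∈) , sym (lincomb-zero k y)
  InSpan-lincomb {k} {y} (suc m) {a} {v} Pa v∈
    with v∈ zero | InSpan-lincomb m (λ i → Pa (suc i)) (λ i → v∈ (suc i))
  ... | c , Pc , v₀≡ | d , Pd , rest≡ =
    (λ j → a zero * c j + d j) , (λ j → +-closed (*-closed (Pa zero) (Pc j)) (Pd j)) , (begin
      a zero * v zero + lincomb K m (λ i → a (suc i)) (λ i → v (suc i))
        ≡⟨ cong₂ (λ x z → a zero * x + z) v₀≡ rest≡ ⟩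
      a zero * lincomb K k c y + lincomb K k d y
        ≡⟨ cong (_+ lincomb K k d y) (lincomb-* k (a zero) c y) ⟨
      lincomb K k (λ j → a zero * c j) y + lincomb K k d y
        ≡⟨ lincomb-+ k _ d y ⟨
      lincomb K k (λ j → a zero * c j + d j) y  ∎)

  independent⇒≢0 : ∀ {t} (w : Fin (suc t) → Carrier) → LinearlyIndependent w → ∀ p → w p ≢ 0#
  independent⇒≢0 {t} w indep p wp≡0 = 0≢1 (begin
    0#              ≡⟨ indep (unitVector p) (unitVector-closed p) unit·w≡0 p ⟨
    unitVector p p  ≡⟨ insertAt-lookup _ p 1# ⟩
    1#              ∎)
    where
    unit·w≡0 : lincomb K (suc t) (unitVector p) w ≡ 0#
    unit·w≡0 = trans (lincomb-unitVector t p w) wp≡0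

  InSpan-tail : ∀ {k} (y : Fin (suc k) → Carrier) {x} (x∈ : InSpan y x) → proj₁ x∈ zero ≡ 0# →
                InSpan (λ j → y (suc j)) x
  InSpan-tail {k} y {x} (c , Pc , x≡) c₀≡0 = (λ j → c (suc j)) , (λ j → Pc (suc j)) , (begin
    x                     ≡⟨ x≡ ⟩
    c zero * y zero + R   ≡⟨ cong (λ a → a * y zero + R) c₀≡0 ⟩
    0# * y zero + R       ≡⟨ solve 2 (λ y R → :0 :* y :+ R := R) refl (y zero) R ⟩
    R                     ∎)
    where
    R = lincomb K k (λ j → c (suc j)) (λ j → y (suc j))

  InSpan-eliminate : ∀ {k} (y : Fin (suc k) → Carrier) {x u} (x∈ : InSpan y x) (u∈ : InSpan y u)
                     (u₀≢0 : proj₁ u∈ zero ≢ 0#) →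
                     InSpan (λ j → y (suc j)) (x - div (proj₁ x∈ zero) (proj₁ u∈ zero) u₀≢0 * u)
  InSpan-eliminate {k} y {x} {u} (a , Pa , x≡) (b , Pb , u≡) b₀≢0 =
    InSpan-tail y (d , (λ j → +-closed (Pa j) (neg-closed (*-closed Pr (Pb j)))) , x-ru≡d·y) d₀≡0
    where
    r = div (a zero) (b zero) b₀≢0
    Pr = div-closed (Pa zero) (Pb zero) b₀≢0
    d : Fin (suc k) → Carrier
    d j = a j - r * b j
    x-ru≡d·y : x - r * u ≡ lincomb K (suc k) d y
    x-ru≡d·y = trans (cong₂ (λ x u → x - r * u) x≡ u≡) (sym (lincomb-subˡ (suc k) r a b y))
    d₀≡0 : d zero ≡ 0#
    d₀≡0 = trans (cong (λ z → a zero - z) (div-*-cancel (a zero) (b zero) b₀≢0)) (-‿inverseʳ (a zero))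

  independent-eliminate : ∀ {t} (w : Fin (suc t) → Carrier) → LinearlyIndependent w →
                          ∀ p {r : Fin t → Carrier} → (∀ i → P (r i)) →
                          LinearlyIndependent (λ i → w (punchIn p i) - r i * w p)
  independent-eliminate {t} w indep p {r} Pr c Pc c·w′≡0 i = begin
    c i                            ≡⟨ insertAt-punchIn c p μ i ⟨
    insertAt c p μ (punchIn p i)   ≡⟨ indep (insertAt c p μ) (insertAt-closed P p Pc Pμ) c″·w≡0 (punchIn p i) ⟩
    0#                             ∎
    where
    μ = - lincomb K t c r
    Pμ = neg-closed (lincomb-closed t Pc Pr)
    c″·w≡0 : lincomb K (suc t) (insertAt c p μ) w ≡ 0#
    c″·w≡0 = begin
      lincomb K (suc t) (insertAt c p μ) w
        ≡⟨ lincomb-insertAt t c p μ w ⟩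
      μ * w p + lincomb K t c (removeAt w p)
        ≡⟨ solve 3 (λ C z U → :- C :* z :+ U := U :- C :* z) refl (lincomb K t c r) (w p) _ ⟩
      lincomb K t c (removeAt w p) - lincomb K t c r * w p
        ≡⟨ lincomb-subʳ t c (removeAt w p) r (w p) ⟨
      lincomb K t c (λ i → w (punchIn p i) - r i * w p)
        ≡⟨ c·w′≡0 ⟩
      0#  ∎

  pivot-reduction : ∀ {k t} (y : Fin (suc k) → Carrier) (w : Fin (suc t) → Carrier) →
                    LinearlyIndependent w → (w∈ : ∀ i → InSpan y (w i)) →
                    ∀ p → proj₁ (w∈ p) zero ≢ 0# →
                    Σ (Fin t → Carrier) λ w′ →
                      LinearlyIndependent w′ × (∀ i → InSpan (λ j → y (suc j)) (w′ i))
  pivot-reduction y w indep w∈ p pivot≢0 =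
    (λ i → w (punchIn p i) - r i * w p) ,
    independent-eliminate w indep p (λ i → div-closed (Pa (punchIn p i) zero) (Pa p zero) pivot≢0) ,
    (λ i → InSpan-eliminate y (w∈ (punchIn p i)) (w∈ p) pivot≢0)
    where
    a = λ i → proj₁ (w∈ i)
    Pa = λ i → proj₁ (proj₂ (w∈ i))
    r = λ i → div (a (punchIn p i) zero) (a p zero) pivot≢0

  independent⇒coefficients-unique : ∀ {t} {w c d : Fin t → Carrier} → LinearlyIndependent w →
                                     (∀ i → P (c i)) → (∀ i → P (d i)) →
                                     lincomb K t c w ≡ lincomb K t d w → ∀ i → c i ≡ d i
  independent⇒coefficients-unique {t} {w} {c} {d} indep Pc Pd c·w≡d·w i = begin
    c i              ≡⟨ x-y≡0⇒x≡y (indep (λ j → c j - 1# * d j) P[c-d] [c-d]·w≡0 i) ⟩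
    1# * d i         ≡⟨ *-identityˡ (d i) ⟩
    d i              ∎
    where
    P[c-d] : ∀ j → P (c j - 1# * d j)
    P[c-d] j = +-closed (Pc j) (neg-closed (*-closed 1∈ (Pd j)))
    [c-d]·w≡0 : lincomb K t (λ j → c j - 1# * d j) w ≡ 0#
    [c-d]·w≡0 = begin
      lincomb K t (λ j → c j - 1# * d j) w          ≡⟨ lincomb-subˡ t 1# c d w ⟩
      lincomb K t c w - 1# * lincomb K t d w        ≡⟨ cong (λ z → z - 1# * lincomb K t d w) c·w≡d·w ⟩
      lincomb K t d w - 1# * lincomb K t d w        ≡⟨ solve 1 (λ x → x :- :1 :* x := :0) refl (lincomb K t d w) ⟩
      0#                                            ∎

  module _ (_≟_ : DecidableEquality Carrier) where

    steinitz : ∀ {k t} (y : Fin k → Carrier) (w : Fin t → Carrier) →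
               LinearlyIndependent w → (∀ i → InSpan y (w i)) → t ≤ k
    steinitz {t = zero} y w indep w∈ = z≤n
    steinitz {zero} {suc t} y w indep w∈ = ⊥-elim (independent⇒≢0 w indep zero (proj₂ (proj₂ (w∈ zero))))
    steinitz {suc k} {suc t} y w indep w∈ with Fin.all? (λ i → proj₁ (w∈ i) zero ≟ 0#)
    ... | yes heads≡0 =
      ℕ.m≤n⇒m≤1+n (steinitz (λ j → y (suc j)) w indep (λ i → InSpan-tail y (w∈ i) (heads≡0 i)))
    ... | no ¬heads≡0 with Fin.¬∀⟶∃¬ (suc t) _ (λ i → proj₁ (w∈ i) zero ≟ 0#) ¬heads≡0
    ...   | p , pivot≢0 with pivot-reduction y w indep w∈ p pivot≢0
    ...     | w′ , w′-independent , w′∈ = s≤s (steinitz (λ j → y (suc j)) w′ w′-independent w′∈)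

module Polynomial (K : Field) where
  open FieldProperties K
  open ≡-Reasoning

  -- Coefficient vectors start with the constant term; evalMonic cs also adds the leading term X ^ k.
  eval : ∀ {k} → Vec Carrier k → Carrier → Carrier
  eval [] x = 0#
  eval (c ∷ cs) x = c + x * eval cs x

  evalMonic : ∀ {k} → Vec Carrier k → Carrier → Carrier
  evalMonic [] x = 1#
  evalMonic (c ∷ cs) x = c + x * evalMonic cs x

  eval-zipWith-- : ∀ {k} (a b : Vec Carrier k) x → eval (Vec.zipWith _-_ a b) x ≡ evalMonic a x - evalMonic b x
  eval-zipWith-- [] [] x = solve 0 (:0 := :1 :- :1) refl
  eval-zipWith-- (a ∷ as) (b ∷ bs) x = begin
    (a - b) + x * eval (Vec.zipWith _-_ as bs) x  ≡⟨ cong (λ e → (a - b) + x * e) (eval-zipWith-- as bs x) ⟩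
    (a - b) + x * (A - B)                         ≡⟨ solve 5 (λ a b x A B → (a :- b) :+ x :* (A :- B)
                                                                        := (a :+ x :* A) :- (b :+ x :* B)) refl a b x A B ⟩
    (a + x * A) - (b + x * B)                     ∎
    where
    A = evalMonic as x
    B = evalMonic bs x

  quotient : ∀ {k} → Carrier → Vec Carrier (suc k) → Vec Carrier k
  quotient z (a ∷ []) = []
  quotient z (a ∷ b ∷ p) = eval (b ∷ p) z ∷ quotient z (b ∷ p)

  eval-quotient : ∀ {k} z (p : Vec Carrier (suc k)) x → eval p x ≡ (x - z) * eval (quotient z p) x + eval p z
  eval-quotient z (a ∷ []) x = solve 3 (λ a x z → a :+ x :* :0 := (x :- z) :* :0 :+ (a :+ z :* :0)) refl a x z
  eval-quotient z (a ∷ b ∷ p) x = begin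
    a + x * eval (b ∷ p) x           ≡⟨ cong (λ e → a + x * e) (eval-quotient z (b ∷ p) x) ⟩
    a + x * ((x - z) * Q + e)        ≡⟨ solve 5 (λ a x z Q e → a :+ x :* ((x :- z) :* Q :+ e)
                                                            := (x :- z) :* (e :+ x :* Q) :+ (a :+ z :* e)) refl a x z Q e ⟩
    (x - z) * (e + x * Q) + (a + z * e) ∎
    where
    Q = eval (quotient z (b ∷ p)) x
    e = eval (b ∷ p) z

  eval-roots : ∀ zs → Unique zs → (p : Vec Carrier (length zs)) → (∀ {z} → z ∈ zs → eval p z ≡ 0#) →
               ∀ x → eval p x ≡ 0#
  eval-roots [] _ [] _ x = refl
  eval-roots (z ∷ zs) (z∉zs ∷ zs-unique) p roots x = begin
    eval p x                        ≡⟨ eval-quotient z p x ⟩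
    (x - z) * eval q x + eval p z   ≡⟨ cong₂ (λ e f → (x - z) * e + f) (eval-roots zs zs-unique q q-roots x)
                                                                        (roots (here refl)) ⟩
    (x - z) * 0# + 0#               ≡⟨ solve 2 (λ x z → (x :- z) :* :0 :+ :0 := :0) refl x z ⟩
    0#                              ∎
    where
    q = quotient z p
    q-roots : ∀ {w} → w ∈ zs → eval q w ≡ 0#
    q-roots {w} w∈zs = x*y≡0⇒y≡0 (λ w-z≡0 → All.lookup z∉zs w∈zs (sym (x-y≡0⇒x≡y w-z≡0))) (begin
      (w - z) * eval q w                ≡⟨ +-identityʳ _ ⟨
      (w - z) * eval q w + 0#           ≡⟨ cong ((w - z) * eval q w +_) (roots (here refl)) ⟨
      (w - z) * eval q w + eval p z     ≡⟨ eval-quotient z p w ⟨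
      eval p w                          ≡⟨ roots (there w∈zs) ⟩
      0#                                ∎)

  monic-unique : ∀ zs → Unique zs → (a b : Vec Carrier (length zs)) →
                 (∀ {z} → z ∈ zs → evalMonic a z ≡ evalMonic b z) → ∀ x → evalMonic a x ≡ evalMonic b x
  monic-unique zs zs-unique a b agree x = x-y≡0⇒x≡y (begin
    evalMonic a x - evalMonic b x       ≡⟨ eval-zipWith-- a b x ⟨
    eval (Vec.zipWith _-_ a b) x        ≡⟨ eval-roots zs zs-unique (Vec.zipWith _-_ a b) roots x ⟩
    0#                                  ∎)
    where
    roots : ∀ {z} → z ∈ zs → eval (Vec.zipWith _-_ a b) z ≡ 0#
    roots {z} z∈zs = trans (eval-zipWith-- a b z) (trans (cong (_- evalMonic b z) (agree z∈zs)) (-‿inverseʳ _))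

  vanishing : List Carrier → Carrier → Carrier
  vanishing zs x = foldr (λ u acc → (x - u) * acc) 1# zs

  addConstant : ∀ {k} → Carrier → Vec Carrier (suc k) → Vec Carrier (suc k)
  addConstant a (d ∷ ds) = (a + d) ∷ ds

  evalMonic-addConstant : ∀ {k} a (v : Vec Carrier (suc k)) x → evalMonic (addConstant a v) x ≡ a + evalMonic v x
  evalMonic-addConstant a (d ∷ ds) x = +-assoc a d _

  mulLinear : ∀ {k} → Carrier → Vec Carrier k → Vec Carrier (suc k)
  mulLinear u [] = - u ∷ []
  mulLinear u (c ∷ cs) = - (u * c) ∷ addConstant c (mulLinear u cs)

  evalMonic-mulLinear : ∀ {k} u (cs : Vec Carrier k) x → evalMonic (mulLinear u cs) x ≡ (x - u) * evalMonic cs x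
  evalMonic-mulLinear u [] x = solve 2 (λ u x → :- u :+ x :* :1 := (x :- u) :* :1) refl u x
  evalMonic-mulLinear u (c ∷ cs) x = begin
    - (u * c) + x * evalMonic (addConstant c (mulLinear u cs)) x
      ≡⟨ cong (λ e → - (u * c) + x * e) (trans (evalMonic-addConstant c (mulLinear u cs) x)
                                               (cong (c +_) (evalMonic-mulLinear u cs x))) ⟩
    - (u * c) + x * (c + (x - u) * M)
      ≡⟨ solve 4 (λ u c x M → :- (u :* c) :+ x :* (c :+ (x :- u) :* M) := (x :- u) :* (c :+ x :* M)) refl u c x M ⟩
    (x - u) * (c + x * M)  ∎
    where
    M = evalMonic cs x

  vanishing-monic : ∀ zs → Σ (Vec Carrier (length zs)) λ c → ∀ x → vanishing zs x ≡ evalMonic c x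
  vanishing-monic [] = [] , λ x → refl
  vanishing-monic (z ∷ zs) with vanishing-monic zs
  ... | c , vanishing≡ = mulLinear z c , λ x →
    trans (cong ((x - z) *_) (vanishing≡ x)) (sym (evalMonic-mulLinear z c x))

  vanishing-root : ∀ {zs z} → z ∈ zs → vanishing zs z ≡ 0#
  vanishing-root {z ∷ zs} (here refl) = trans (cong (_* vanishing zs z) (-‿inverseʳ z)) (zeroˡ _)
  vanishing-root {u ∷ zs} {z} (there z∈zs) = trans (cong ((z - u) *_) (vanishing-root z∈zs)) (zeroʳ _)

  vanishing≡0⇒∈ : DecidableEquality Carrier → ∀ zs {x} → vanishing zs x ≡ 0# → x ∈ zs
  vanishing≡0⇒∈ _≟_ [] 1≡0 = ⊥-elim (0≢1 (sym 1≡0))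
  vanishing≡0⇒∈ _≟_ (z ∷ zs) {x} product≡0 with x ≟ z
  ... | yes refl = here refl
  ... | no x≢z =
    there (vanishing≡0⇒∈ _≟_ zs (x*y≡0⇒y≡0 (λ x-z≡0 → x≢z (x-y≡0⇒x≡y x-z≡0)) product≡0))

  vanishing≡X^q-X : ∀ zs → Unique zs → 2 ≤ length zs → (∀ {z} → z ∈ zs → z ^ length zs ≡ z) →
                    ∀ x → vanishing zs x ≡ x ^ length zs - x
  vanishing≡X^q-X (_ ∷ []) _ (s≤s ()) _ _
  vanishing≡X^q-X zs@(_ ∷ _ ∷ rest) zs-unique _ fixed x with vanishing-monic zs
  ... | c , vanishing≡ = begin
    vanishing zs x       ≡⟨ vanishing≡ x ⟩
    evalMonic c x        ≡⟨ monic-unique zs zs-unique c X^q-X agree x ⟩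
    evalMonic X^q-X x        ≡⟨ evalMonic-X^q-X x ⟩
    x ^ length zs - x    ∎
    where
    X^q-X : Vec Carrier (length zs)
    X^q-X = 0# ∷ - 1# ∷ Vec.replicate (length rest) 0#
    evalMonic-replicate : ∀ k y → evalMonic (Vec.replicate k 0#) y ≡ y ^ k
    evalMonic-replicate zero y = refl
    evalMonic-replicate (suc k) y = trans (+-identityˡ _) (cong (y *_) (evalMonic-replicate k y))
    evalMonic-X^q-X : ∀ y → evalMonic X^q-X y ≡ y ^ length zs - y
    evalMonic-X^q-X y = trans (cong (λ e → 0# + y * (- 1# + y * e)) (evalMonic-replicate (length rest) y))
                          (solve 2 (λ y e → :0 :+ y :* (:- :1 :+ y :* e) := y :* (y :* e) :- y) refl y (y ^ length rest))
    agree : ∀ {z} → z ∈ zs → evalMonic c z ≡ evalMonic X^q-X z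
    agree {z} z∈zs = begin
      evalMonic c z       ≡⟨ vanishing≡ z ⟨
      vanishing zs z      ≡⟨ vanishing-root z∈zs ⟩
      0#                  ≡⟨ -‿inverseʳ z ⟨
      z - z               ≡⟨ cong (_- z) (fixed z∈zs) ⟨
      z ^ length zs - z   ≡⟨ evalMonic-X^q-X z ⟨
      evalMonic X^q-X z       ∎

module Fermat (K : Field) where
  open FieldProperties K
  open ≡-Reasoning
  open import Data.List.Relation.Binary.Permutation.Setoid.Properties (≡.setoid Carrier) using (foldr-commMonoid)

  product : List Carrier → Carrier
  product = foldr _*_ 1#

  product-↭ : ∀ {xs ys} → xs ↭ ys → product xs ≡ product ys
  product-↭ xs↭ys = foldr-commMonoid *-isCommutativeMonoid (↭⇒↭ₛ xs↭ys)

  product-map-* : ∀ a zs → product (List.map (a *_) zs) ≡ a ^ length zs * product zs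
  product-map-* a [] = sym (*-identityˡ 1#)
  product-map-* a (z ∷ zs) = trans (cong ((a * z) *_) (product-map-* a zs))
    (solve 4 (λ a z A P → (a :* z) :* (A :* P) := (a :* A) :* (z :* P)) refl a z (a ^ length zs) (product zs))

  product≢0 : ∀ {zs} → All (_≢ 0#) zs → product zs ≢ 0#
  product≢0 [] 1≡0 = 0≢1 (sym 1≡0)
  product≢0 (z≢0 ∷ zs≢0) = *-≢0 z≢0 (product≢0 zs≢0)

  ^length≡1 : ∀ {a} zs → a ≢ 0# → Unique zs → All (_≢ 0#) zs →
              (∀ {z} → z ∈ zs → a * z ∈ zs) →
              (∀ {z} → z ∈ zs → ∃ λ z′ → z′ ∈ zs × z ≡ a * z′) →
              a ^ length zs ≡ 1#
  ^length≡1 {a} zs a≢0 zs-unique zs≢0 closed onto = *-cancelˡ-≢0 (product≢0 zs≢0) (begin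
    product zs * a ^ length zs     ≡⟨ *-comm _ _ ⟩
    a ^ length zs * product zs     ≡⟨ product-map-* a zs ⟨
    product (List.map (a *_) zs)   ≡⟨ product-↭ (∼bag⇒↭ (unique∧set⇒bag a*zs-unique zs-unique (mk⇔ to from))) ⟩
    product zs                     ≡⟨ *-identityʳ _ ⟨
    product zs * 1#                ∎)
    where
    a*zs-unique : Unique (List.map (a *_) zs)
    a*zs-unique = Unique.map⁺ (*-cancelˡ-≢0 a≢0) zs-unique
    to : ∀ {x} → x ∈ List.map (a *_) zs → x ∈ zs
    to x∈ with ∈-map⁻ (a *_) x∈
    ... | z , z∈zs , refl = closed z∈zs
    from : ∀ {x} → x ∈ zs → x ∈ List.map (a *_) zs
    from x∈ with onto x∈
    ... | z , z∈zs , refl = ∈-map⁺ (a *_) z∈zs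

  module _ (_≟_ : DecidableEquality Carrier) (E : Subfield K) where
    open Subfield E

    nonzero : List Carrier
    nonzero = filter (λ z → ¬? (z ≟ 0#)) elems

    ∈-elems : ∀ {x} → mem x → x ∈ elems
    ∈-elems {x} = Equivalence.to (complete x)

    ∈-nonzero⁺ : ∀ {x} → mem x → x ≢ 0# → x ∈ nonzero
    ∈-nonzero⁺ mx x≢0 = ∈-filter⁺ (λ z → ¬? (z ≟ 0#)) (∈-elems mx) x≢0

    ∈-nonzero⁻ : ∀ {x} → x ∈ nonzero → mem x × x ≢ 0#
    ∈-nonzero⁻ {x} x∈ with ∈-filter⁻ (λ z → ¬? (z ≟ 0#)) x∈
    ... | x∈elems , x≢0 = Equivalence.from (complete x) x∈elems , x≢0

    elems↭0∷nonzero : elems ↭ 0# ∷ nonzero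
    elems↭0∷nonzero = ∼bag⇒↭ (unique∧set⇒bag unique 0∷nonzero-unique (mk⇔ to from))
      where
      0∷nonzero-unique : Unique (0# ∷ nonzero)
      0∷nonzero-unique = All.tabulate (λ x∈ 0≡x → proj₂ (∈-nonzero⁻ x∈) (sym 0≡x))
                         ∷ Unique.filter⁺ (λ z → ¬? (z ≟ 0#)) unique
      to : ∀ {x} → x ∈ elems → x ∈ 0# ∷ nonzero
      to {x} x∈ with x ≟ 0#
      ... | yes refl = here refl
      ... | no x≢0 = there (∈-filter⁺ (λ z → ¬? (z ≟ 0#)) x∈ x≢0)
      from : ∀ {x} → x ∈ 0# ∷ nonzero → x ∈ elems
      from (here refl) = ∈-elems 0∈
      from (there x∈) = proj₁ (∈-filter⁻ (λ z → ¬? (z ≟ 0#)) x∈)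

    subfield-fermat : ∀ {a} → mem a → a ^ order K E ≡ a
    subfield-fermat {a} ma with a ≟ 0#
    ... | yes refl = trans (cong (0# ^_) (↭-length elems↭0∷nonzero)) (zeroˡ _)
    ... | no a≢0 with inv a a≢0
    ...   | a⁻¹ , aa⁻¹≡1 = begin
      a ^ length elems            ≡⟨ cong (a ^_) (↭-length elems↭0∷nonzero) ⟩
      a * a ^ length nonzero      ≡⟨ cong (a *_) (^length≡1 nonzero a≢0 nonzero-unique nonzero≢0 closed onto) ⟩
      a * 1#                      ≡⟨ *-identityʳ a ⟩
      a                           ∎
      where
      nonzero-unique : Unique nonzero
      nonzero-unique = Unique.filter⁺ _ unique
      nonzero≢0 : All (_≢ 0#) nonzero
      nonzero≢0 = All.tabulate (λ x∈ → proj₂ (∈-nonzero⁻ x∈))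
      ma⁻¹ : mem a⁻¹
      ma⁻¹ = inv-closed ma aa⁻¹≡1
      a⁻¹≢0 : a⁻¹ ≢ 0#
      a⁻¹≢0 a⁻¹≡0 = 0≢1 (trans (sym (zeroʳ a)) (trans (cong (a *_) (sym a⁻¹≡0)) aa⁻¹≡1))
      closed : ∀ {z} → z ∈ nonzero → a * z ∈ nonzero
      closed z∈ with ∈-nonzero⁻ z∈
      ... | mz , z≢0 = ∈-nonzero⁺ (*-closed ma mz) (*-≢0 a≢0 z≢0)
      onto : ∀ {z} → z ∈ nonzero → ∃ λ z′ → z′ ∈ nonzero × z ≡ a * z′
      onto {z} z∈ with ∈-nonzero⁻ z∈
      ... | mz , z≢0 = a⁻¹ * z , ∈-nonzero⁺ (*-closed ma⁻¹ mz) (*-≢0 a⁻¹≢0 z≢0) , (begin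
        z                ≡⟨ *-identityˡ z ⟨
        1# * z           ≡⟨ cong (_* z) aa⁻¹≡1 ⟨
        (a * a⁻¹) * z    ≡⟨ *-assoc a a⁻¹ z ⟩
        a * (a⁻¹ * z)    ∎)

    even-order⇒characteristic-two : ∀ m → order K E ≡ 2 ℕ.* m → 1# + 1# ≡ 0#
    even-order⇒characteristic-two m q≡2m = begin
      1# + 1#                ≡⟨ cong (1# +_) -1≡1 ⟨
      1# + - 1#              ≡⟨ -‿inverseʳ 1# ⟩
      0#                     ∎
      where
      -1≡1 : - 1# ≡ 1#
      -1≡1 = begin
        - 1#                     ≡⟨ subfield-fermat (neg-closed 1∈) ⟨
        (- 1#) ^ order K E       ≡⟨ cong ((- 1#) ^_) q≡2m ⟩
        (- 1#) ^ (2 ℕ.* m)       ≡⟨ ^-assocʳ (- 1#) 2 m ⟨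
        ((- 1#) ^ 2) ^ m         ≡⟨ cong (_^ m) (solve 0 ((:- :1) :^ 2 := :1) refl) ⟩
        1# ^ m                   ≡⟨ 1^n≡1 m ⟩
        1#                       ∎

module SubspacePolynomial (K : Field) (_≟_ : DecidableEquality (Field.Carrier K))
                          (E : Subfield K) (l : ℕ) (|E|≡2^[1+l] : order K E ≡ 2 ℕ.^ suc l) where
  open FieldProperties K
  open Polynomial K
  open Fermat K
  open Subfield E
  open ≡-Reasoning

  q : ℕ
  q = order K E

  L≡X^q-X : ∀ x → L K E x ≡ x ^ q - x
  L≡X^q-X = vanishing≡X^q-X elems unique 2≤q (λ {z} z∈ → subfield-fermat _≟_ E (Equivalence.from (complete z) z∈))
    where
    2≤q : 2 ≤ q
    2≤q = subst (2 ≤_) (sym |E|≡2^[1+l]) (ℕ.*-monoʳ-≤ 2 (ℕ.m^n>0 2 l))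

  frobenius-q : ∀ x y → (x + y) ^ q ≡ x ^ q + y ^ q
  frobenius-q x y = subst (λ n → (x + y) ^ n ≡ x ^ n + y ^ n) (sym |E|≡2^[1+l])
    (frobenius (even-order⇒characteristic-two _≟_ E (2 ℕ.^ l) |E|≡2^[1+l]) (suc l) x y)

  L-isLinear : IsLinear K mem (L K E)
  L-isLinear = record { +-homo = L-+ ; *-homo = L-* }
    where
    L-+ : ∀ x y → L K E (x + y) ≡ L K E x + L K E y
    L-+ x y = begin
      L K E (x + y)                ≡⟨ L≡X^q-X (x + y) ⟩
      (x + y) ^ q - (x + y)        ≡⟨ cong (_- (x + y)) (frobenius-q x y) ⟩
      (x ^ q + y ^ q) - (x + y)    ≡⟨ solve 4 (λ X Y x y → (X :+ Y) :- (x :+ y) := (X :- x) :+ (Y :- y))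
                                              refl (x ^ q) (y ^ q) x y ⟩
      (x ^ q - x) + (y ^ q - y)    ≡⟨ cong₂ _+_ (L≡X^q-X x) (L≡X^q-X y) ⟨
      L K E x + L K E y            ∎
    L-* : ∀ {a} x → mem a → L K E (a * x) ≡ a * L K E x
    L-* {a} x ma = begin
      L K E (a * x)                ≡⟨ L≡X^q-X (a * x) ⟩
      (a * x) ^ q - a * x          ≡⟨ cong (_- a * x) (^-distrib-* a x q) ⟩
      a ^ q * x ^ q - a * x        ≡⟨ cong (λ c → c * x ^ q - a * x) (subfield-fermat _≟_ E ma) ⟩
      a * x ^ q - a * x            ≡⟨ solve 3 (λ a X x → a :* X :- a :* x := a :* (X :- x)) refl a (x ^ q) x ⟩
      a * (x ^ q - x)              ≡⟨ cong (a *_) (L≡X^q-X x) ⟨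
      a * L K E x                  ∎

  L≡0⇒∈E : ∀ {x} → L K E x ≡ 0# → mem x
  L≡0⇒∈E {x} Lx≡0 = Equivalence.from (complete x) (vanishing≡0⇒∈ _≟_ elems Lx≡0)

module LinearMap (K : Field) (_≟_ : DecidableEquality (Field.Carrier K))
                 {P : Subset K} (P-subfield : IsSubfield K P)
                 {f : Field.Carrier K → Field.Carrier K} (f-linear : IsLinear K P f) where
  open FieldProperties K
  open LinearCombination K
  open Span K P-subfield
  open IsSubfield P-subfield
  open IsLinear f-linear
  open ≡-Reasoning

  f-0 : f 0# ≡ 0#
  f-0 = begin
    f 0#          ≡⟨ cong f (zeroˡ 0#) ⟨
    f (0# * 0#)   ≡⟨ *-homo 0# 0∈ ⟩
    0# * f 0#     ≡⟨ zeroˡ (f 0#) ⟩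
    0#            ∎

  f-- : ∀ x y → f (x - y) ≡ f x - f y
  f-- x y = begin
    f (x - y)            ≡⟨ cong f (solve 2 (λ x y → x :- y := x :+ (:- :1) :* y) refl x y) ⟩
    f (x + - 1# * y)     ≡⟨ +-homo x (- 1# * y) ⟩
    f x + f (- 1# * y)   ≡⟨ cong (f x +_) (*-homo y (neg-closed 1∈)) ⟩
    f x + - 1# * f y     ≡⟨ solve 2 (λ X Y → X :+ (:- :1) :* Y := X :- Y) refl (f x) (f y) ⟩
    f x - f y            ∎

  f-lincomb : ∀ m {a} (v : Fin m → Carrier) → (∀ i → P (a i)) →
              f (lincomb K m a v) ≡ lincomb K m a (λ i → f (v i))
  f-lincomb zero v Pa = f-0
  f-lincomb (suc m) {a} v Pa = begin
    f (a zero * v zero + lincomb K m (λ i → a (suc i)) (λ i → v (suc i)))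
      ≡⟨ +-homo _ _ ⟩
    f (a zero * v zero) + f (lincomb K m (λ i → a (suc i)) (λ i → v (suc i)))
      ≡⟨ cong₂ _+_ (*-homo (v zero) (Pa zero)) (f-lincomb m (λ i → v (suc i)) (λ i → Pa (suc i))) ⟩
    lincomb K (suc m) a (λ i → f (v i))  ∎

  span-image : ∀ {U V : Subset K} → (∀ {v} → V v → U (f v)) → ∀ {x} → span K P V x → span K P U (f x)
  span-image V→U (m , a , v , Pa , Vv , x≡) =
    m , a , (λ i → f (v i)) , Pa , (λ i → V→U (Vv i)) , trans (cong f x≡) (f-lincomb m v Pa)

  span-lift : ∀ {U V : Subset K} → (∀ {u} → U u → Σ Carrier λ v → V v × f v ≡ u) →
              ∀ {u} → span K P U u → Σ Carrier λ v → span K P V v × f v ≡ u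
  span-lift {U} {V} lift {u} (m , a , w , Pa , Uw , u≡) =
    lincomb K m a v , (m , a , v , Pa , (λ i → proj₁ (proj₂ (lift (Uw i)))) , refl) , (begin
      f (lincomb K m a v)                ≡⟨ f-lincomb m v Pa ⟩
      lincomb K m a (λ i → f (v i))      ≡⟨ lincomb-cong m (λ i → cong (a i *_) (proj₂ (proj₂ (lift (Uw i))))) ⟩
      lincomb K m a w                    ≡⟨ u≡ ⟨
      u                                  ∎)
    where
    v : Fin m → Carrier
    v i = proj₁ (lift (Uw i))

  image-lift : ∀ {U V} → ImageIs K f V U → ∀ {u} → U u → Σ Carrier λ v → V v × f v ≡ u
  image-lift V↠U {u} = Equivalence.to (V↠U u)

  image-into : ∀ {U V} → ImageIs K f V U → ∀ {v} → V v → U (f v)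
  image-into V↠U {v} Vv = Equivalence.from (V↠U (f v)) (v , Vv , refl)

  dim-span-image≤ : ∀ {U V s t} → ImageIs K f V U →
                    HasDim K P (span K P U) s → HasDim K P (span K P V) t → s ≤ t
  dim-span-image≤ {U} {V} {s} {t} V↠U (e , e-basis) (w , w-basis) =
    steinitz _≟_ (λ i → f (w i)) e (IsBasis.independent e-basis) e∈
    where
    e∈ : ∀ j → InSpan (λ i → f (w i)) (e j)
    e∈ j with span-lift {U} {V} (image-lift V↠U) (IsBasis.inS e-basis j)
    ... | v , v∈ , fv≡ej with IsBasis.spanning w-basis v v∈
    ...   | c , Pc , v≡ = c , Pc , (begin
      e j                           ≡⟨ fv≡ej ⟨
      f v                           ≡⟨ cong f v≡ ⟩
      f (lincomb K t c w)           ≡⟨ f-lincomb t w Pc ⟩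
      lincomb K t c (λ i → f (w i)) ∎)

  dim-span≤suc-dim-span-image : ∀ {U V s t} → (∀ {x} → f x ≡ 0# → P x) → ImageIs K f V U →
                                HasDim K P (span K P U) s → HasDim K P (span K P V) t → t ≤ suc s
  dim-span≤suc-dim-span-image {U} {V} {s} {t} kernel⊆P V↠U (e , e-basis) (w , w-basis) =
    steinitz _≟_ g w (IsBasis.independent w-basis) w∈
    where
    preimage : ∀ j → Σ Carrier λ v → span K P V v × f v ≡ e j
    preimage j = span-lift {U} {V} (image-lift V↠U) (IsBasis.inS e-basis j)
    y : Fin s → Carrier
    y j = proj₁ (preimage j)
    g : Fin (suc s) → Carrier
    g zero = 1#
    g (suc j) = y j
    w∈ : ∀ i → InSpan g (w i)
    w∈ i with IsBasis.spanning e-basis (f (w i))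
                (span-image {U} {V} (image-into V↠U) (IsBasis.inS w-basis i))
    ... | c , Pc , fwᵢ≡ = d , Pd , sym (solve 2 (λ w Y → (w :- Y) :* :1 :+ Y := w) refl (w i) Y)
      where
      Y = lincomb K s c y
      fY≡fwᵢ : f Y ≡ f (w i)
      fY≡fwᵢ = begin
        f Y                            ≡⟨ f-lincomb s y Pc ⟩
        lincomb K s c (λ j → f (y j))  ≡⟨ lincomb-cong s (λ j → cong (c j *_) (proj₂ (proj₂ (preimage j)))) ⟩
        lincomb K s c e                ≡⟨ fwᵢ≡ ⟨
        f (w i)                        ∎
      d : Fin (suc s) → Carrier
      d zero = w i - Y
      d (suc j) = c j
      Pd : ∀ j → P (d j)
      Pd zero = kernel⊆P (begin
        f (w i - Y)        ≡⟨ f-- (w i) Y ⟩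
        f (w i) - f Y      ≡⟨ cong (λ z → f (w i) - z) fY≡fwᵢ ⟩
        f (w i) - f (w i)  ≡⟨ -‿inverseʳ (f (w i)) ⟩
        0#                 ∎)
      Pd (suc j) = Pc j

  span-⊇ : ∀ {S : Subset K} {x} → S x → span K P S x
  span-⊇ {x = x} Sx =
    1 , (λ _ → 1#) , (λ _ → x) , (λ _ → 1∈) , (λ _ → Sx) , solve 1 (λ x → x := :1 :* x :+ :0) refl x

  module Construction {F : Subset K} (F⊆P : ∀ {a} → F a → P a)
                      {U : Subset K} (U-subspace : IsSubspace K F U) (U⊆range : InRange K f U)
                      {r s : ℕ} {b : Fin r → Carrier} (b-basis : IsBasis K F U r b)
                      {e : Fin s → Carrier} (e-basis : IsBasis K P (span K P U) s e) where
    private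
      module U = IsSubspace U-subspace
      module b = IsBasis b-basis
      module e = IsBasis e-basis

    preimage : ∀ j → Σ Carrier λ x → span K P (λ _ → ⊤) x × f x ≡ e j
    preimage j = span-lift {U} {λ _ → ⊤} (λ {u} Uu → proj₁ (U⊆range u Uu) , tt , proj₂ (U⊆range u Uu))
                           (e.inS j)

    y : Fin s → Carrier
    y j = proj₁ (preimage j)

    f-lincomb-y : ∀ {c} → (∀ j → P (c j)) → f (lincomb K s c y) ≡ lincomb K s c e
    f-lincomb-y {c} Pc =
      trans (f-lincomb s y Pc) (lincomb-cong s (λ j → cong (c j *_) (proj₂ (proj₂ (preimage j)))))

    f-injective-on-span-y : ∀ {x x′} → InSpan y x → InSpan y x′ → f x ≡ f x′ → x ≡ x′
    f-injective-on-span-y {x} {x′} (c , Pc , x≡) (c′ , Pc′ , x′≡) fx≡fx′ = begin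
      x                  ≡⟨ x≡ ⟩
      lincomb K s c y    ≡⟨ lincomb-cong s (λ j → cong (_* y j) (c≡c′ j)) ⟩
      lincomb K s c′ y   ≡⟨ x′≡ ⟨
      x′                 ∎
      where
      c·e≡c′·e : lincomb K s c e ≡ lincomb K s c′ e
      c·e≡c′·e = begin
        lincomb K s c e      ≡⟨ f-lincomb-y Pc ⟨
        f (lincomb K s c y)  ≡⟨ cong f x≡ ⟨
        f x                  ≡⟨ fx≡fx′ ⟩
        f x′                 ≡⟨ cong f x′≡ ⟩
        f (lincomb K s c′ y) ≡⟨ f-lincomb-y Pc′ ⟩
        lincomb K s c′ e     ∎
      c≡c′ : ∀ j → c j ≡ c′ j
      c≡c′ = independent⇒coefficients-unique e.independent Pc Pc′ c·e≡c′·e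

    V : Subset K
    V x = InSpan y x × U (f x)

    span-V⊆span-y : ∀ {x} → span K P V x → InSpan y x
    span-V⊆span-y (m , a , v , Pa , Vv , x≡) =
      subst (InSpan y) (sym x≡) (InSpan-lincomb m Pa (λ i → proj₁ (Vv i)))

    V-isSubspace : IsSubspace K F V
    V-isSubspace = record
      { 0∈ = ((λ _ → 0#) , (λ _ → 0∈) , sym (lincomb-zero s y)) , subst U (sym f-0) U.0∈
      ; +-closed = λ { {x} {x′} ((c , Pc , x≡) , Ufx) ((c′ , Pc′ , x′≡) , Ufx′) →
          ((λ j → c j + c′ j) , (λ j → +-closed (Pc j) (Pc′ j)) ,
           trans (cong₂ _+_ x≡ x′≡) (sym (lincomb-+ s c c′ y))) ,
          subst U (sym (+-homo x x′)) (U.+-closed Ufx Ufx′) }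
      ; ·-closed = λ { {a} {x} Fa ((c , Pc , x≡) , Ufx) →
          ((λ j → a * c j) , (λ j → *-closed (F⊆P Fa) (Pc j)) ,
           trans (cong (a *_) x≡) (sym (lincomb-* s a c y))) ,
          subst U (sym (*-homo x (F⊆P Fa))) (U.·-closed Fa Ufx) }
      }

    V-lift : ∀ {u} → U u → Σ Carrier λ v → V v × f v ≡ u
    V-lift {u} Uu with e.spanning u (span-⊇ Uu)
    ... | c , Pc , u≡ = lincomb K s c y , ((c , Pc , refl) , subst U (sym fv≡u) Uu) , fv≡u
      where
      fv≡u : f (lincomb K s c y) ≡ u
      fv≡u = trans (f-lincomb-y Pc) (sym u≡)

    V↠U : ImageIs K f V U
    V↠U u = mk⇔ V-lift (λ { (v , (_ , Ufv) , fv≡u) → subst U fv≡u Ufv })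

    v : Fin r → Carrier
    v i = proj₁ (V-lift (b.inS i))

    f-lincomb-v : ∀ {c} → (∀ i → F (c i)) → f (lincomb K r c v) ≡ lincomb K r c b
    f-lincomb-v {c} Fc = trans (f-lincomb r v (λ i → F⊆P (Fc i)))
                               (lincomb-cong r (λ i → cong (c i *_) (proj₂ (proj₂ (V-lift (b.inS i))))))

    V-basis : IsBasis K F V r v
    V-basis = record
      { inS = λ i → proj₁ (proj₂ (V-lift (b.inS i)))
      ; independent = λ c Fc c·v≡0 → b.independent c Fc (trans (sym (f-lincomb-v Fc)) (trans (cong f c·v≡0) f-0))
      ; spanning = spanning
      }
      where
      spanning : ∀ x → V x → Σ (Fin r → Carrier) λ c → (∀ i → F (c i)) × (x ≡ lincomb K r c v)
      spanning x (x∈span-y , Ufx) with b.spanning (f x) Ufx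
      ... | c , Fc , fx≡ = c , Fc , f-injective-on-span-y x∈span-y
        (InSpan-lincomb r (λ i → F⊆P (Fc i)) (λ i → proj₁ (proj₁ (proj₂ (V-lift (b.inS i))))))
        (trans fx≡ (sym (f-lincomb-v Fc)))

    span-V-basis : IsBasis K P (span K P V) s y
    span-V-basis = record
      { inS = y∈span-V
      ; independent = λ c Pc c·y≡0 → e.independent c Pc (trans (sym (f-lincomb-y Pc)) (trans (cong f c·y≡0) f-0))
      ; spanning = λ x x∈ → span-V⊆span-y x∈
      }
      where
      y∈span-V : ∀ j → span K P V (y j)
      y∈span-V j with span-lift {U} {V} V-lift (e.inS j)
      ... | z , z∈span-V , fz≡eⱼ = subst (span K P V) (sym yⱼ≡z) z∈span-V
        where
        yⱼ≡z : y j ≡ z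
        yⱼ≡z = f-injective-on-span-y (InSpan-generator y j) (span-V⊆span-y z∈span-V)
                 (trans (proj₂ (proj₂ (preimage j))) (sym fz≡eⱼ))

singleton-∈ : ∀ {A : Set} {xs : List A} {x y} → length xs ≡ 1 → x ∈ xs → y ∈ xs → x ≡ y
singleton-∈ {xs = _ ∷ []} _ (here refl) (here refl) = refl

open import Data.Nat using (_^_)

lemma3p2 : (n l : ℕ) → l ∣ n →
    (K : Field) → HasCard (Field.Carrier K) (2 ^ n) →
    (E : Subfield K) → order K E ≡ 2 ^ l →
    (U : Subset K) → IsSubspace K (F₂ K) U → InRange K (L K E) U →
    (r s : ℕ) → HasDim K (F₂ K) U r → HasDim K (Subfield.mem E) (span K (Subfield.mem E) U) s →
    ((V : Subset K) → IsSubspace K (F₂ K) V → HasDim K (F₂ K) V r → ImageIs K (L K E) V U →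
       (t : ℕ) → HasDim K (Subfield.mem E) (span K (Subfield.mem E) V) t → (s ≤ t) × (t ≤ suc s))
    × Σ (Subset K) (λ V → IsSubspace K (F₂ K) V × HasDim K (F₂ K) V r × ImageIs K (L K E) V U
         × HasDim K (Subfield.mem E) (span K (Subfield.mem E) V) s)
lemma3p2 n zero _ K _ E |E|≡1 _ _ _ _ _ _ _ =
  ⊥-elim (Field.0≢1 K (singleton-∈ |E|≡1 (∈-elems (Subfield.0∈ E)) (∈-elems (Subfield.1∈ E))))
  where
  ∈-elems : ∀ {x} → Subfield.mem E x → x ∈ Subfield.elems E
  ∈-elems {x} = Equivalence.to (Subfield.complete E x)
lemma3p2 n (suc l) _ K card E |E|≡2^[1+l] U U-subspace U⊆range r s (b , b-basis) (e , e-basis) =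
  (λ V _ _ V↠U t span-V-dim →
     dim-span-image≤ V↠U (e , e-basis) span-V-dim ,
     dim-span≤suc-dim-span-image L≡0⇒∈E V↠U (e , e-basis) span-V-dim) ,
  (V , V-isSubspace , (v , V-basis) , V↠U , (y , span-V-basis))
  where
  -- The order of K only serves to make its equality decidable.
  _≟_ : DecidableEquality (Field.Carrier K)
  _≟_ = Fin.inj⇒≟ (↔⇒↣ card)
  open SubspacePolynomial K _≟_ E l |E|≡2^[1+l]
  open LinearMap K _≟_ (subfield⇒isSubfield K E) L-isLinear
  open Construction (F₂⊆subfield K E) U-subspace U⊆range b-basis e-basis
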